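{- Let $c\in\mathbb{N}$, let $G$ be a graph and let $I\subseteq V(G)$ be a $c$-inseparable set with $|I|\ge c+1$. Then $A := \{a\in V(G) \mid I\cup\{a\} \text{ is } c\text{ -inseparable}\}$ is the unique maximal $c$-inseparable set in $G$ with $I\subseteq A$.
   Context: Graphs are finite, simple, undirected. A separation of $G$ is a pair $(A,B)$ with $A\cup B=V(G)$ and no edge between $A\setminus B$ and $B\setminus A$; it separates vertices $x,y$ if $x\in A\setminus B$, $y\in B\setminus A$. A clique separator is $A\cap B$ for a separation $(A,B)$ separating two vertices such that $G[A\cap B]$ is a clique (the empty set counts as a clique); its size is $|A\cap B|$. Two vertices are $c$-inseparable if no clique separator of size at most $c$ in $G$ separates them. A set is $c$-inseparable if any two distinct elements are $c$-inseparable, and maximal $c$-inseparable if no proper superset in $V(G)$ is $c$-inseparable. -}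

module Defs where

open import Data.Nat using (ℕ; suc; _≤_)
open import Data.Bool using (Bool; true; false)
open import Data.Fin using (Fin)
open import Data.Fin.Subset using (Subset; _∈_; _∉_; _⊆_; _⊂_; _∩_; ∣_∣)
open import Data.Product using (Σ; _×_; ∃₂)
open import Data.Sum using (_⊎_)
open import Relation.Nullary using (¬_)
open import Relation.Binary.PropositionalEquality using (_≡_; _≢_)

record Graph : Set where
  field
    n      : ℕ
    adj    : Fin n → Fin n → Bool
    symm   : ∀ u v → adj u v ≡ adj v u
    noLoop : ∀ v → adj v v ≡ false

open Graph public

V : Graph → Set
V G = Fin (n G)

VSet : Graph → Set
VSet G = Subset (n G)

E : (G : Graph) → V G → V G → Set
E G u v = adj G u v ≡ true

IsSeparation : (G : Graph) → VSet G → VSet G → Set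
IsSeparation G X Y =
  (∀ v → v ∈ X ⊎ v ∈ Y) ×
  (∀ u v → u ∈ X → u ∉ Y → v ∈ Y → v ∉ X → ¬ E G u v)

Separates : (G : Graph) → VSet G → VSet G → V G → V G → Set
Separates G X Y x y = (x ∈ X × x ∉ Y) × (y ∈ Y × y ∉ X)

IsClique : (G : Graph) → VSet G → Set
IsClique G S = ∀ u v → u ∈ S → v ∈ S → u ≢ v → E G u v

SepByCliqueSep : (c : ℕ) (G : Graph) → V G → V G → Set
SepByCliqueSep c G x y =
  ∃₂ λ (X Y : VSet G) →
    IsSeparation G X Y × Separates G X Y x y ×
    IsClique G (X ∩ Y) × ∣ X ∩ Y ∣ ≤ c

Inseparable : (c : ℕ) (G : Graph) → V G → V G → Set
Inseparable c G x y = ¬ SepByCliqueSep c G x y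

InseparableSet : (c : ℕ) (G : Graph) → VSet G → Set
InseparableSet c G S =
  ∀ x y → x ∈ S → y ∈ S → x ≢ y → Inseparable c G x y

MaximalInseparable : (c : ℕ) (G : Graph) → VSet G → Set
MaximalInseparable c G S =
  InseparableSet c G S × (∀ T → S ⊂ T → ¬ InseparableSet c G T)

module Submission where

-- Let I be c-inseparable with |I| ≥ c + 1 and let A be the set of
-- vertices a for which I ∪ {a} is c-inseparable.
--   * A clique separator X ∩ Y of size ≤ c cannot contain all of I, so some
--     i ∈ I lies strictly on one side of the separation.  If the separation
--     separated a from b, it would then also separate i from b, or a from i.
--     Hence any two distinct elements of A are c-inseparable.
--   * Subsets of c-inseparable sets are c-inseparable, so I ⊆ A and every
--     c-inseparable superset T of I lies inside A (each t ∈ T has I ∪ {t} ⊆ T).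
--   * So A is the greatest c-inseparable superset of I, and the greatest member
--     of this family is maximal and equal to every maximal member containing I.

open import Defs
open import Data.Nat using (ℕ; suc; _≤_; _<_)
open import Data.Nat.Properties using (≤⇒≯; ≤-<-trans)
open import Data.Fin.Subset using (Subset; _∈_; _∉_; _⊆_; _⊂_; _∩_; _∪_; ⁅_⁆; ∣_∣)
open import Data.Fin.Subset.Properties
  using (_∈?_; p⊆q⇒∣p∣≤∣q∣; x∈p∩q⁺; x∈p∪q⁻; p⊆p∪q; q⊆p∪q; x∈⁅x⁆; x∈⁅y⁆⇒x≡y; ⊆-antisym)
open import Data.Fin using (Fin)
open import Data.Fin.Properties using (¬∀⟶∃¬)
open import Data.Product using (_×_; _,_; ∃)
open import Data.Sum using (_⊎_; inj₁; inj₂)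
open import Function.Bundles using (_⇔_; Equivalence)
open import Relation.Nullary using (¬_; yes; no; contradiction)
open import Relation.Nullary.Decidable using (_→-dec_)
open import Relation.Binary.PropositionalEquality using (_≡_; _≢_; refl; sym; subst)

module _ {n : ℕ} where

  element-outside : (I S : Subset n) → ∣ S ∣ < ∣ I ∣ → ∃ λ i → i ∈ I × i ∉ S
  element-outside I S S<I
    with ¬∀⟶∃¬ n (λ i → i ∈ I → i ∈ S) (λ i → i ∈? I →-dec i ∈? S) I⊈S
    where
    I⊈S : ¬ (∀ i → i ∈ I → i ∈ S)
    I⊈S I⊆S = ≤⇒≯ (p⊆q⇒∣p∣≤∣q∣ (λ {i} → I⊆S i)) S<I
  ... | i , ¬[i∈I→i∈S] with i ∈? I | i ∈? S
  ...   | yes i∈I | no i∉S  = i , i∈I , i∉S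
  ...   | _       | yes i∈S = contradiction (λ _ → i∈S) ¬[i∈I→i∈S]
  ...   | no i∉I  | _       = contradiction (λ i∈I → contradiction i∈I i∉I) ¬[i∈I→i∈S]

  ∪-singleton-⊆ : {I T : Subset n} {a : Fin n} → I ⊆ T → a ∈ T → I ∪ ⁅ a ⁆ ⊆ T
  ∪-singleton-⊆ {I} {T} {a} I⊆T a∈T x∈ with x∈p∪q⁻ I ⁅ a ⁆ x∈
  ... | inj₁ x∈I = I⊆T x∈I
  ... | inj₂ x∈a = subst (_∈ T) (sym (x∈⁅y⁆⇒x≡y a x∈a)) a∈T

module _ {G : Graph} {X Y : VSet G} where

  separated-distinct : ∀ {x y} → Separates G X Y x y → x ≢ y
  separated-distinct ((x∈X , _) , (_ , y∉X)) refl = y∉X x∈X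

  separation-splits : IsSeparation G X Y → ∀ {x y z} → Separates G X Y x y →
                      z ∉ X ∩ Y → Separates G X Y z y ⊎ Separates G X Y x z
  separation-splits (cover , _) {z = z} (x-side , y-side) z∉X∩Y with cover z
  ... | inj₁ z∈X = inj₁ ((z∈X , λ z∈Y → z∉X∩Y (x∈p∩q⁺ (z∈X , z∈Y))) , y-side)
  ... | inj₂ z∈Y = inj₂ (x-side , (z∈Y , λ z∈X → z∉X∩Y (x∈p∩q⁺ (z∈X , z∈Y))))

module _ (c : ℕ) (G : Graph) where

  inseparable-⊆ : ∀ {S T} → InseparableSet c G S → T ⊆ S → InseparableSet c G T
  inseparable-⊆ insS T⊆S x y x∈T y∈T = insS x y (T⊆S x∈T) (T⊆S y∈T)

  extensions-inseparable :
    (I : VSet G) → suc c ≤ ∣ I ∣ → ∀ a b →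
    InseparableSet c G (I ∪ ⁅ a ⁆) → InseparableSet c G (I ∪ ⁅ b ⁆) →
    a ≢ b → Inseparable c G a b
  extensions-inseparable I c<∣I∣ a b insIa insIb _
                         (X , Y , sep , a|b , clique , small)
    with element-outside I (X ∩ Y) (≤-<-trans small c<∣I∣)
  ... | i , i∈I , i∉X∩Y with separation-splits {G = G} {X} {Y} sep a|b i∉X∩Y
  ...   | inj₁ i|b = insIb i b (p⊆p∪q ⁅ b ⁆ i∈I) (q⊆p∪q I ⁅ b ⁆ (x∈⁅x⁆ b))
                           (separated-distinct {G = G} {X} {Y} i|b) (X , Y , sep , i|b , clique , small)
  ...   | inj₂ a|i = insIa a i (q⊆p∪q I ⁅ a ⁆ (x∈⁅x⁆ a)) (p⊆p∪q ⁅ a ⁆ i∈I)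
                           (separated-distinct {G = G} {X} {Y} a|i) (X , Y , sep , a|i , clique , small)

  Greatest : VSet G → VSet G → Set
  Greatest I A = InseparableSet c G A × I ⊆ A ×
                 (∀ T → InseparableSet c G T → I ⊆ T → T ⊆ A)

  greatest⇒unique-maximal :
    ∀ {I A} → Greatest I A →
    MaximalInseparable c G A × I ⊆ A × (∀ B → MaximalInseparable c G B → I ⊆ B → B ≡ A)
  greatest⇒unique-maximal {I} {A} (insA , I⊆A , bound) =
    (insA , maximal) , I⊆A , unique
    where
    maximal : ∀ T → A ⊂ T → ¬ InseparableSet c G T
    maximal T (A⊆T , t , t∈T , t∉A) insT = t∉A (bound T insT (λ i∈I → A⊆T (I⊆A i∈I)) t∈T)

    unique : ∀ B → MaximalInseparable c G B → I ⊆ B → B ≡ A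
    unique B (insB , maxB) I⊆B = ⊆-antisym B⊆A A⊆B
      where
      B⊆A : B ⊆ A
      B⊆A = bound B insB I⊆B
      A⊆B : A ⊆ B
      A⊆B {x} x∈A with x ∈? B
      ... | yes x∈B = x∈B
      ... | no x∉B  = contradiction insA (maxB A (B⊆A , x , x∈A , x∉B))

lemma6 : (c : ℕ) (G : Graph) (I : VSet G) →
         InseparableSet c G I → suc c ≤ ∣ I ∣ →
         (A : VSet G) → (∀ a → (a ∈ A) ⇔ InseparableSet c G (I ∪ ⁅ a ⁆)) →
         MaximalInseparable c G A × I ⊆ A ×
         (∀ B → MaximalInseparable c G B → I ⊆ B → B ≡ A)
lemma6 c G I insI c<∣I∣ A A-spec = greatest⇒unique-maximal c G (insA , I⊆A , bound)
  where
  bound : ∀ T → InseparableSet c G T → I ⊆ T → T ⊆ A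
  bound T insT I⊆T {t} t∈T =
    Equivalence.from (A-spec t) (inseparable-⊆ c G insT (∪-singleton-⊆ I⊆T t∈T))

  I⊆A : I ⊆ A
  I⊆A = bound I insI (λ i∈I → i∈I)

  insA : InseparableSet c G A
  insA a b a∈A b∈A =
    extensions-inseparable c G I c<∣I∣ a b
      (Equivalence.to (A-spec a) a∈A) (Equivalence.to (A-spec b) b∈A)
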